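{- Let $g,\ell$ be positive integers such that $\frac{g}{\ell}=\frac{2}{c}$ for some $c\in\mathbb{N}$. Then there exist $0\le\varepsilon<\frac14$ and $\delta>0$ such that for any $n,t$ and any function $f:(\{0,1\}^n)^\ell\to\{0,1\}^t$ there exists a uniform $(g,\ell)$-NOSF source $\mathbf{X}$ over $(\{0,1\}^n)^\ell$ for which $$H_\infty^\varepsilon(f(\mathbf{X}))\le \frac{g}{\ell}\cdot t+\delta.$$
   Context: A uniform $(g,\ell)$-NOSF (non-oblivious symbol fixing) source over $(\{0,1\}^n)^\ell$ is a random variable $\mathbf{X}=(\mathbf{X}_1,\dots,\mathbf{X}_\ell)$, each $\mathbf{X}_i$ taking values in $\{0,1\}^n$, for which there is a set $G\subseteq[\ell]$ of at least $g$ indices ("good blocks") such that the blocks $\mathbf{X}_i$, $i\in G$, are mutually independent and each uniformly distributed on $\{0,1\}^n$, while every other block $\mathbf{X}_j$, $j\notin G$, is an arbitrary function of the good blocks $(\mathbf{X}_i)_{i\in G}$. For a random variable $\mathbf{Z}$, $H_\infty^\varepsilon(\mathbf{Z})=\max\{H_\infty(\mathbf{Z}') : \mathbf{Z}'\text{ is within statistical distance }\varepsilon\text{ of }\mathbf{Z}\}$, where $H_\infty(\mathbf{Z}')=-\log_2\max_z\Pr[\mathbf{Z}'=z]$. -}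

module Defs where

open import Data.Bool using (Bool; true; false)
open import Data.Nat as ℕ using (ℕ; zero; suc)
open import Data.Integer as ℤ using (ℤ; +_; -[1+_])
open import Data.Rational using (ℚ; 0ℚ; 1ℚ; ½; _+_; _-_; _*_; ∣_∣; _≤_; ↥_; ↧ₙ_; _/_)
open import Data.Fin using (Fin)
open import Data.Vec using (Vec; []; _∷_; lookup)
open import Data.List as List using (List; []; _∷_; _++_; map; concatMap; filter; length; foldr)
open import Data.Vec.Properties using (≡-dec)
open import Data.Bool.Properties using () renaming (_≟_ to _≟B_)
open import Data.Product using (Σ; ∃; _×_; _,_)
open import Relation.Binary.PropositionalEquality using (_≡_)
open import Function.Definitions using (Injective)

Bits : ℕ → Set
Bits n = Vec Bool n

allVecs : {A : Set} → List A → (k : ℕ) → List (Vec A k)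
allVecs xs zero    = [] ∷ []
allVecs xs (suc k) = concatMap (λ x → map (x ∷_) (allVecs xs k)) xs

allBits : (n : ℕ) → List (Bits n)
allBits n = allVecs (false ∷ true ∷ []) n

_^ℚ_ : ℚ → ℕ → ℚ
q ^ℚ zero  = 1ℚ
q ^ℚ suc m = q * (q ^ℚ m)

two : ℚ
two = 1ℚ + 1ℚ

pow2ℤ : ℤ → ℚ
pow2ℤ (+ m)      = two ^ℚ m
pow2ℤ -[1+ m ]   = ½ ^ℚ suc m

sumBits : (t : ℕ) → (Bits t → ℚ) → ℚ
sumBits t p = foldr (λ z s → p z + s) 0ℚ (allBits t)

IsDistribution : (t : ℕ) → (Bits t → ℚ) → Set
IsDistribution t p = ((z : Bits t) → 0ℚ ≤ p z) × sumBits t p ≡ 1ℚ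

SD : (t : ℕ) → (Bits t → ℚ) → (Bits t → ℚ) → ℚ
SD t p q = ½ * sumBits t (λ z → ∣ p z - q z ∣)

-- 2^{-a} ≤ x, for x ≥ 0; with a = num/den this is 2^{-num} ≤ x^den
TwoPowNegLe : ℚ → ℚ → Set
TwoPowNegLe a x = pow2ℤ (ℤ.- (↥ a)) ≤ x ^ℚ (↧ₙ a)

-- H_∞(p) ≤ a   ⇔   max_z p z ≥ 2^{-a}
MinEntropyLe : (t : ℕ) → (Bits t → ℚ) → ℚ → Set
MinEntropyLe t p a = ∃ λ (z : Bits t) → TwoPowNegLe a (p z)

-- H_∞^ε(p) ≤ a   ⇔   every distribution within statistical distance ε of p
-- has min-entropy ≤ a
SmoothMinEntropyLe : (t : ℕ) → ℚ → (Bits t → ℚ) → ℚ → Set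
SmoothMinEntropyLe t ε p a =
  (q : Bits t → ℚ) → IsDistribution t q → SD t p q ≤ ε → MinEntropyLe t q a

-- A uniform (g,ℓ)-NOSF source over ({0,1}^n)^ℓ, presented as:
--  k ≥ g good blocks, at injective positions pos : Fin k → Fin ℓ,
--  and a map src sending the good-block values y ∈ ({0,1}^n)^k (uniform)
--  to the full ℓ-block string, which must place y j at position pos j;
--  the remaining blocks of src y are arbitrary functions of y.
record NOSF (g ℓ n : ℕ) : Set where
  field
    k       : ℕ
    g≤k     : g ℕ.≤ k
    pos     : Fin k → Fin ℓ
    pos-inj : Injective _≡_ _≡_ pos
    src     : Vec (Bits n) k → Vec (Bits n) ℓ
    good    : (y : Vec (Bits n) k) (j : Fin k) → lookup (src y) (pos j) ≡ lookup y j

countPre : {g ℓ n t : ℕ} → NOSF g ℓ n → (Vec (Bits n) ℓ → Bits t) → Bits t → ℕ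
countPre {n = n} X f z =
  length (filter (λ y → ≡-dec _≟B_ (f (NOSF.src X y)) z) (allVecs (allBits n) (NOSF.k X)))

distOf : {g ℓ n t : ℕ} → NOSF g ℓ n → (Vec (Bits n) ℓ → Bits t) → Bits t → ℚ
distOf {n = n} X f z = (+ countPre X f z / 1) * (½ ^ℚ (n ℕ.* NOSF.k X))

-- Take ε = 0 and δ = 1. By pigeonhole some output z has a fibre A = f⁻¹(z) with |A| ≥ 2^{nℓ-t}.
-- Cut the ℓ blocks into runs. If g divides ℓ, use ℓ/g runs of g blocks: iterating
-- |A| ≤ |heads A|·|tails A| yields a run S with |A| ≤ |π_S A|^{ℓ/g}. Otherwise c is odd,
-- g = 2h and ℓ = c h: with runs of h blocks, Loomis–Whitney on three runs and the same product
-- bound on the remaining pairs of runs yield two runs S with |A|² ≤ |π_S A|^c. Either way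
-- |π_S A| ≥ 2^{ng - tg/ℓ}. The source draws the blocks of S uniformly and sets the others to a point
-- of A extending them whenever there is one, so Pr[f(X) = z] ≥ |π_S A| / 2^{ng} ≥ 2^{-tg/ℓ}.

module Submission where

module Combinatorics where

  open import Data.Bool using (Bool; true; false; T; _∧_)
  open import Data.Bool.Properties using (T-∧) renaming (_≟_ to _≟ᵇ_)
  open import Data.Empty using (⊥-elim)
  open import Data.Fin as Fin using (Fin; _↑ˡ_; _↑ʳ_; splitAt; join)
  open import Data.Fin.Properties using (splitAt-join; join-splitAt; ↑ʳ-injective)
  open import Data.Bool.ListAction using (any)
  open import Data.List using (List; []; _∷_; _++_; map; concat; concatMap; length; filter)
  open import Data.List.Properties using (length-++; length-map)
  open import Data.List.Membership.Propositional using (_∈_; find; lose)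
  open import Data.List.Membership.Propositional.Properties using (∈-map⁺; ∈-concatMap⁺)
  open import Data.List.Relation.Unary.Any using (here; there; any?)
  open import Data.List.Relation.Unary.Any.Properties using (any⁺; any⁻)
  open import Data.Nat using (ℕ; zero; suc; _+_; _*_; _^_; _≤_; z≤n; NonZero; ≢-nonZero⁻¹)
  open import Data.Nat.Properties
  open import Data.Nat.Tactic.RingSolver using (solve-∀)
  open import Data.Product using (∃; _×_; _,_; proj₁; proj₂)
  open import Data.Sum using (_⊎_; inj₁; inj₂; map₂)
  open import Data.Sum.Properties using (inj₂-injective)
  open import Data.Unit using (tt)
  open import Data.Vec using (Vec; []; _∷_; lookup; take; drop; replicate) renaming (_++_ to _++ᵛ_)
  open import Data.Vec.Properties using (≡-dec; lookup-splitAt; take++drop≡id)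
  open import Function using (_∘_; Equivalence)
  open import Function.Construct.Composition using () renaming (injective to ∘-injective)
  open import Function.Definitions using (Injective)
  open import Relation.Binary.Definitions using (DecidableEquality)
  open import Relation.Binary.PropositionalEquality
  open import Relation.Nullary using (Dec; yes; no)
  open import Relation.Nullary.Decidable using (⌊_⌋; toWitness; fromWitness; T?)

  open import Defs using (allVecs; Bits; allBits; NOSF; countPre)

  𝟙 : Bool → ℕ
  𝟙 true  = 1
  𝟙 false = 0

  𝟙-mono : ∀ {b c} → (T b → T c) → 𝟙 b ≤ 𝟙 c
  𝟙-mono {false}          _ = z≤n
  𝟙-mono {true}  {true}   _ = ≤-refl
  𝟙-mono {true}  {false}  h = ⊥-elim (h tt)

  𝟙-≤-* : ∀ {p b c} → (T p → T b) → (T p → T c) → 𝟙 p ≤ 𝟙 b * 𝟙 c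
  𝟙-≤-* {false}                  _  _  = z≤n
  𝟙-≤-* {true}  {true}  {true}   _  _  = ≤-refl
  𝟙-≤-* {true}  {false}          hb _  = ⊥-elim (hb tt)
  𝟙-≤-* {true}  {true}  {false}  _  hc = ⊥-elim (hc tt)

  ∑ : {A : Set} → List A → (A → ℕ) → ℕ
  ∑ []       f = 0
  ∑ (x ∷ xs) f = f x + ∑ xs f

  infix 5 ∑
  syntax ∑ xs (λ x → e) = ∑[ x ∈ xs ] e

  count : {A : Set} → List A → (A → Bool) → ℕ
  count xs P = ∑[ x ∈ xs ] 𝟙 (P x)

  module _ {A : Set} where

    ∑-++ : (xs ys : List A) (f : A → ℕ) → ∑ (xs ++ ys) f ≡ ∑ xs f + ∑ ys f
    ∑-++ []       ys f = refl
    ∑-++ (x ∷ xs) ys f = trans (cong (f x +_) (∑-++ xs ys f)) (sym (+-assoc (f x) _ _))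

    ∑-cong : (xs : List A) {f g : A → ℕ} → (∀ x → x ∈ xs → f x ≡ g x) → ∑ xs f ≡ ∑ xs g
    ∑-cong []       h = refl
    ∑-cong (x ∷ xs) h = cong₂ _+_ (h x (here refl)) (∑-cong xs (λ y m → h y (there m)))

    ∑-mono : (xs : List A) {f g : A → ℕ} → (∀ x → x ∈ xs → f x ≤ g x) → ∑ xs f ≤ ∑ xs g
    ∑-mono []       h = z≤n
    ∑-mono (x ∷ xs) h = +-mono-≤ (h x (here refl)) (∑-mono xs (λ y m → h y (there m)))

    ∑-*ʳ : (xs : List A) (f : A → ℕ) (c : ℕ) → ∑[ x ∈ xs ] f x * c ≡ ∑ xs f * c
    ∑-*ʳ []       f c = refl
    ∑-*ʳ (x ∷ xs) f c = trans (cong (f x * c +_) (∑-*ʳ xs f c)) (sym (*-distribʳ-+ c (f x) (∑ xs f)))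

    ∑-+ : (xs : List A) (f g : A → ℕ) → ∑[ x ∈ xs ] (f x + g x) ≡ ∑ xs f + ∑ xs g
    ∑-+ []       f g = refl
    ∑-+ (x ∷ xs) f g = trans (cong (f x + g x +_) (∑-+ xs f g)) (+-interchange (f x) (g x) (∑ xs f) (∑ xs g))
      where
      +-interchange : ∀ a b c d → a + b + (c + d) ≡ a + c + (b + d)
      +-interchange = solve-∀

    ∑-zero : (xs : List A) → ∑[ x ∈ xs ] 0 ≡ 0
    ∑-zero []       = refl
    ∑-zero (x ∷ xs) = ∑-zero xs

    ∑-const : (xs : List A) (c : ℕ) → ∑[ x ∈ xs ] c ≡ length xs * c
    ∑-const []       c = refl
    ∑-const (x ∷ xs) c = cong (c +_) (∑-const xs c)

    ∑-≥-member : (xs : List A) (f : A → ℕ) {x : A} → x ∈ xs → f x ≤ ∑ xs f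
    ∑-≥-member (y ∷ xs) f (here refl) = m≤m+n (f y) _
    ∑-≥-member (y ∷ xs) f (there m)   = ≤-trans (∑-≥-member xs f m) (m≤n+m _ (f y))

    ∑-≤-length*maximum : (xs : List A) (f : A → ℕ) → A → ∃ λ z → ∑ xs f ≤ length xs * f z
    ∑-≤-length*maximum []       f z₀ = z₀ , z≤n
    ∑-≤-length*maximum (x ∷ xs) f z₀ with ∑-≤-length*maximum xs f z₀
    ... | z , h with f x ≤? f z
    ...   | yes fx≤fz = z , +-mono-≤ fx≤fz h
    ...   | no  fx≰fz = x , +-monoʳ-≤ (f x) (≤-trans h (*-monoʳ-≤ (length xs) (<⇒≤ (≰⇒> fx≰fz))))

    ∑-*ˡ : (xs : List A) (c : ℕ) (f : A → ℕ) → ∑[ x ∈ xs ] c * f x ≡ c * ∑ xs f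
    ∑-*ˡ xs c f = trans (∑-cong xs (λ x _ → *-comm c (f x))) (trans (∑-*ʳ xs f c) (*-comm (∑ xs f) c))

  module _ {A B : Set} where

    ∑-map : (g : A → B) (xs : List A) (f : B → ℕ) → ∑ (map g xs) f ≡ ∑[ x ∈ xs ] f (g x)
    ∑-map g []       f = refl
    ∑-map g (x ∷ xs) f = cong (f (g x) +_) (∑-map g xs f)

    ∑-concatMap : (g : A → List B) (xs : List A) (f : B → ℕ) → ∑ (concatMap g xs) f ≡ ∑[ x ∈ xs ] ∑ (g x) f
    ∑-concatMap g []       f = refl
    ∑-concatMap g (x ∷ xs) f = trans (∑-++ (g x) (concat (map g xs)) f) (cong (∑ (g x) f +_) (∑-concatMap g xs f))

    ∑-comm : (xs : List A) (ys : List B) (f : A → B → ℕ) → ∑[ x ∈ xs ] ∑[ y ∈ ys ] f x y ≡ ∑[ y ∈ ys ] ∑[ x ∈ xs ] f x y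
    ∑-comm []       ys f = sym (∑-zero ys)
    ∑-comm (x ∷ xs) ys f = trans (cong (∑ ys (f x) +_) (∑-comm xs ys f)) (sym (∑-+ ys (f x) (λ y → ∑[ x ∈ xs ] f x y)))

    length-concatMap : (g : A → List B) (xs : List A) → length (concatMap g xs) ≡ ∑[ x ∈ xs ] length (g x)
    length-concatMap g []       = refl
    length-concatMap g (x ∷ xs) = trans (length-++ (g x)) (cong (length (g x) +_) (length-concatMap g xs))

  count-⊆-× : {A B : Set} (xs : List A) (ys : List B) (P : A → B → Bool) (E : A → Bool) (F : B → Bool) →
    (∀ {a b} → a ∈ xs → b ∈ ys → T (P a b) → T (E a)) →
    (∀ {a b} → a ∈ xs → b ∈ ys → T (P a b) → T (F b)) →
    ∑[ a ∈ xs ] count ys (P a) ≤ count xs E * count ys F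
  count-⊆-× xs ys P E F P⇒E P⇒F = begin
    ∑[ a ∈ xs ] ∑[ b ∈ ys ] 𝟙 (P a b)         ≤⟨ ∑-mono xs (λ a a∈ → ∑-mono ys (λ b b∈ → 𝟙-≤-* (P⇒E a∈ b∈) (P⇒F a∈ b∈))) ⟩
    ∑[ a ∈ xs ] ∑[ b ∈ ys ] 𝟙 (E a) * 𝟙 (F b) ≡⟨ ∑-cong xs (λ a _ → ∑-*ˡ ys (𝟙 (E a)) (λ b → 𝟙 (F b))) ⟩
    ∑[ a ∈ xs ] 𝟙 (E a) * count ys F          ≡⟨ ∑-*ʳ xs (λ a → 𝟙 (E a)) (count ys F) ⟩
    count xs E * count ys F                   ∎
    where open ≤-Reasoning

  ^-cancelʳ-≤ : ∀ {x y} ℓ .{{_ : NonZero ℓ}} → x ^ ℓ ≤ y ^ ℓ → x ≤ y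
  ^-cancelʳ-≤ {x} {y} ℓ xˡ≤yˡ with x ≤? y
  ... | yes x≤y = x≤y
  ... | no  x≰y = ⊥-elim (<⇒≱ (^-monoˡ-< ℓ (≰⇒> x≰y)) xˡ≤yˡ)

  *-self-cancel-≤ : ∀ {a b} → a * a ≤ b * b → a ≤ b
  *-self-cancel-≤ {a} {b} = ^-cancelʳ-≤ 2 ∘ subst₂ _≤_ (square a) (square b)
    where
    square : ∀ x → x * x ≡ x ^ 2
    square x = cong (x *_) (sym (*-identityʳ x))

  four-*-≤-square-ordered : ∀ {u v} → u ≤ v → 4 * (u * v) ≤ (u + v) * (u + v)
  four-*-≤-square-ordered {u} u≤v with m≤n⇒∃[o]m+o≡n u≤v
  ... | d , refl = subst (4 * (u * (u + d)) ≤_) (sym (square-expand u d)) (m≤m+n _ (d * d))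
    where
    square-expand : ∀ u d → (u + (u + d)) * (u + (u + d)) ≡ 4 * (u * (u + d)) + d * d
    square-expand = solve-∀

  four-*-≤-square : ∀ u v → 4 * (u * v) ≤ (u + v) * (u + v)
  four-*-≤-square u v with ≤-total u v
  ... | inj₁ u≤v = four-*-≤-square-ordered u≤v
  ... | inj₂ v≤u = subst₂ _≤_ (cong (4 *_) (*-comm v u)) (cong₂ _*_ (+-comm v u) (+-comm v u)) (four-*-≤-square-ordered v≤u)

  square-+-≤ : ∀ K c x y C X Y → c * c ≤ K * (x * y) → C * C ≤ K * (X * Y) →
    (c + C) * (c + C) ≤ K * ((x + X) * (y + Y))
  square-+-≤ K c x y C X Y h₁ h₂ = begin
    (c + C) * (c + C)                                ≡⟨ expand-left c C ⟩
    c * c + C * C + 2 * (c * C)                      ≤⟨ +-mono-≤ (+-mono-≤ h₁ h₂) cross ⟩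
    K * (x * y) + K * (X * Y) + K * (x * Y + X * y)  ≡⟨ expand-right K x y X Y ⟩
    K * ((x + X) * (y + Y))                          ∎
    where
    open ≤-Reasoning
    expand-left : ∀ c C → (c + C) * (c + C) ≡ c * c + C * C + 2 * (c * C)
    expand-left = solve-∀
    expand-right : ∀ K x y X Y → K * (x * y) + K * (X * Y) + K * (x * Y + X * y) ≡ K * ((x + X) * (y + Y))
    expand-right = solve-∀
    regroup₁ : ∀ c C → (2 * (c * C)) * (2 * (c * C)) ≡ 4 * ((c * c) * (C * C))
    regroup₁ = solve-∀
    regroup₂ : ∀ K x y X Y → 4 * ((K * (x * y)) * (K * (X * Y))) ≡ (K * K) * (4 * ((x * Y) * (X * y)))
    regroup₂ = solve-∀
    regroup₃ : ∀ K s → (K * K) * (s * s) ≡ (K * s) * (K * s)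
    regroup₃ = solve-∀
    -- AM-GM: (2cC)² ≤ 4K²(xY)(Xy) ≤ K²(xY + Xy)²
    cross : 2 * (c * C) ≤ K * (x * Y + X * y)
    cross = *-self-cancel-≤ (begin
      (2 * (c * C)) * (2 * (c * C))                   ≡⟨ regroup₁ c C ⟩
      4 * ((c * c) * (C * C))                         ≤⟨ *-monoʳ-≤ 4 (*-mono-≤ h₁ h₂) ⟩
      4 * ((K * (x * y)) * (K * (X * Y)))             ≡⟨ regroup₂ K x y X Y ⟩
      (K * K) * (4 * ((x * Y) * (X * y)))             ≤⟨ *-monoʳ-≤ (K * K) (four-*-≤-square (x * Y) (X * y)) ⟩
      (K * K) * ((x * Y + X * y) * (x * Y + X * y))   ≡⟨ regroup₃ K (x * Y + X * y) ⟩
      (K * (x * Y + X * y)) * (K * (x * Y + X * y))   ∎)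

  ∑-cauchySchwarz : {A : Set} (xs : List A) (K : ℕ) (t x y : A → ℕ) →
    (∀ a → a ∈ xs → t a * t a ≤ K * (x a * y a)) →
    ∑ xs t * ∑ xs t ≤ K * (∑ xs x * ∑ xs y)
  ∑-cauchySchwarz []       K t x y h = z≤n
  ∑-cauchySchwarz (a ∷ xs) K t x y h =
    square-+-≤ K (t a) (x a) (y a) (∑ xs t) (∑ xs x) (∑ xs y) (h a (here refl))
      (∑-cauchySchwarz xs K t x y (λ b b∈ → h b (there b∈)))

  loomisWhitney : {A B C : Set} (xs : List A) (ys : List B) (zs : List C) (P : A → B → C → Bool) →
    let ∣P∣   = ∑[ a ∈ xs ] ∑[ b ∈ ys ] count zs (P a b)
        ∣P₁₂∣ = ∑[ a ∈ xs ] count ys (λ b → any (P a b) zs)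
        ∣P₁₃∣ = ∑[ a ∈ xs ] count zs (λ c → any (λ b → P a b c) ys)
        ∣P₂₃∣ = ∑[ b ∈ ys ] count zs (λ c → any (λ a → P a b c) xs)
    in ∣P∣ * ∣P∣ ≤ ∣P₂₃∣ * (∣P₁₂∣ * ∣P₁₃∣)
  loomisWhitney xs ys zs P = ∑-cauchySchwarz xs ∣P₂₃∣ fibre shadow₂ shadow₃ fibre-bound
    where
    ∣P₂₃∣ = ∑[ b ∈ ys ] count zs (λ c → any (λ a → P a b c) xs)
    fibre shadow₂ shadow₃ : _ → ℕ
    fibre a   = ∑[ b ∈ ys ] count zs (P a b)
    shadow₂ a = count ys (λ b → any (P a b) zs)
    shadow₃ a = count zs (λ c → any (λ b → P a b c) ys)
    fibre-bound : ∀ a → a ∈ xs → fibre a * fibre a ≤ ∣P₂₃∣ * (shadow₂ a * shadow₃ a)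
    fibre-bound a a∈ = *-mono-≤
      (∑-mono ys (λ b _ → ∑-mono zs (λ c _ → 𝟙-mono (λ p → any⁺ (λ a → P a b c) (lose a∈ p)))))
      (count-⊆-× ys zs (P a) _ _ (λ _ c∈ p → any⁺ (P a _) (lose c∈ p)) (λ b∈ _ p → any⁺ (λ b → P a b _) (lose b∈ p)))

  module _ {B : Set} (xs : List B) where

    allVecs-complete : (∀ b → b ∈ xs) → ∀ k (v : Vec B k) → v ∈ allVecs xs k
    allVecs-complete complete zero    []      = here refl
    allVecs-complete complete (suc k) (b ∷ v) =
      ∈-concatMap⁺ (λ b → map (b ∷_) (allVecs xs k)) (lose (complete b) (∈-map⁺ (b ∷_) (allVecs-complete complete k v)))

    length-allVecs : ∀ k → length (allVecs xs k) ≡ length xs ^ k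
    length-allVecs zero    = refl
    length-allVecs (suc k) = begin
      length (concatMap (λ b → map (b ∷_) (allVecs xs k)) xs) ≡⟨ length-concatMap _ xs ⟩
      ∑[ b ∈ xs ] length (map (b ∷_) (allVecs xs k))          ≡⟨ ∑-cong xs (λ b _ → length-map (b ∷_) (allVecs xs k)) ⟩
      ∑[ b ∈ xs ] length (allVecs xs k)                       ≡⟨ ∑-const xs _ ⟩
      length xs * length (allVecs xs k)                       ≡⟨ cong (length xs *_) (length-allVecs k) ⟩
      length xs * length xs ^ k                               ∎
      where open ≡-Reasoning

    ∑-allVecs-cons : ∀ k (F : Vec B (suc k) → ℕ) → ∑ (allVecs xs (suc k)) F ≡ ∑[ b ∈ xs ] ∑[ v ∈ allVecs xs k ] F (b ∷ v)
    ∑-allVecs-cons k F = trans (∑-concatMap _ xs F) (∑-cong xs (λ b _ → ∑-map (b ∷_) (allVecs xs k) F))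

    ∑-allVecs-++ : ∀ a b (F : Vec B (a + b) → ℕ) →
      ∑ (allVecs xs (a + b)) F ≡ ∑[ u ∈ allVecs xs a ] ∑[ v ∈ allVecs xs b ] F (u ++ᵛ v)
    ∑-allVecs-++ zero    b F = sym (+-identityʳ _)
    ∑-allVecs-++ (suc a) b F = begin
      ∑ (allVecs xs (suc a + b)) F                                              ≡⟨ ∑-allVecs-cons (a + b) F ⟩
      ∑[ c ∈ xs ] ∑[ w ∈ allVecs xs (a + b) ] F (c ∷ w)                          ≡⟨ ∑-cong xs (λ c _ → ∑-allVecs-++ a b (F ∘ (c ∷_))) ⟩
      ∑[ c ∈ xs ] ∑[ u ∈ allVecs xs a ] ∑[ v ∈ allVecs xs b ] F (c ∷ u ++ᵛ v)    ≡⟨ ∑-allVecs-cons a _ ⟨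
      ∑[ u ∈ allVecs xs (suc a) ] ∑[ v ∈ allVecs xs b ] F (u ++ᵛ v)              ∎
      where open ≡-Reasoning

  module _ {B : Set} where

    take-++ : ∀ {a b} (u : Vec B a) (v : Vec B b) → take a (u ++ᵛ v) ≡ u
    take-++ []      v = refl
    take-++ (x ∷ u) v = cong (x ∷_) (take-++ u v)

    drop-++ : ∀ {a b} (u : Vec B a) (v : Vec B b) → drop a (u ++ᵛ v) ≡ v
    drop-++ []      v = refl
    drop-++ (x ∷ u) v = drop-++ u v

    lookup-take : ∀ a {b} (w : Vec B (a + b)) (i : Fin a) → lookup (take a w) i ≡ lookup w (i ↑ˡ b)
    lookup-take (suc a) (x ∷ w) Fin.zero    = refl
    lookup-take (suc a) (x ∷ w) (Fin.suc i) = lookup-take a w i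

    lookup-drop : ∀ a {b} (w : Vec B (a + b)) (i : Fin b) → lookup (drop a w) i ≡ lookup w (a ↑ʳ i)
    lookup-drop zero    w       i = refl
    lookup-drop (suc a) (x ∷ w) i = lookup-drop a w i

  splitAt-injective : ∀ a {b} → Injective _≡_ _≡_ (splitAt a {b})
  splitAt-injective a {b} {i} {j} eq = trans (sym (join-splitAt a b i)) (trans (cong (join a b) eq) (join-splitAt a b j))

  join-injective : ∀ a b → Injective _≡_ _≡_ (join a b)
  join-injective a b {i} {j} eq = trans (sym (splitAt-join a b i)) (trans (cong (splitAt a) eq) (splitAt-join a b j))

  map₂-injective : {A B C : Set} {f : B → C} → Injective _≡_ _≡_ f → Injective _≡_ _≡_ (map₂ {A = A} f)
  map₂-injective f-inj {inj₁ _} {inj₁ _} refl = refl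
  map₂-injective f-inj {inj₂ _} {inj₂ _} eq   = cong inj₂ (f-inj (inj₂-injective eq))

  data Selection : ℕ → ℕ → Set where
    done : ∀ {y} → Selection 0 y
    keep : ∀ a {x y} → Selection x y → Selection (a + x) (a + y)
    skip : ∀ a {x y} → Selection x y → Selection x (a + y)

  position : ∀ {x y} → Selection x y → Fin x → Fin y
  position done         ()
  position (keep a {y = y} e) = join a y ∘ map₂ (position e) ∘ splitAt a
  position (skip a e)   = (a ↑ʳ_) ∘ position e

  position-injective : ∀ {x y} (e : Selection x y) → Injective _≡_ _≡_ (position e)
  position-injective done         {()}
  position-injective (keep a {y = y} e) =
    ∘-injective _≡_ _≡_ _≡_ (splitAt-injective a) (∘-injective _≡_ _≡_ _≡_ (map₂-injective (position-injective e)) (join-injective a y))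
  position-injective (skip a e) = ∘-injective _≡_ _≡_ _≡_ (position-injective e) (↑ʳ-injective a _ _)

  module _ {B : Set} where

    restrict : ∀ {x y} → Selection x y → Vec B y → Vec B x
    restrict done       w = []
    restrict (keep a e) w = take a w ++ᵛ restrict e (drop a w)
    restrict (skip a e) w = restrict e (drop a w)

    lookup-restrict : ∀ {x y} (e : Selection x y) (w : Vec B y) (j : Fin x) → lookup (restrict e w) j ≡ lookup w (position e j)
    lookup-restrict done       w ()
    lookup-restrict (keep a {y = y} e) w j
      rewrite lookup-splitAt a (take a w) (restrict e (drop a w)) j with splitAt a j
    ... | inj₁ i = lookup-take a w i
    ... | inj₂ i = trans (lookup-restrict e (drop a w) i) (lookup-drop a w (position e i))
    lookup-restrict (skip a e) w j = trans (lookup-restrict e (drop a w) j) (lookup-drop a w (position e j))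

    restrict-keep-++ : ∀ a {x y} (e : Selection x y) (u : Vec B a) (w : Vec B y) →
      restrict (keep a e) (u ++ᵛ w) ≡ u ++ᵛ restrict e w
    restrict-keep-++ a e u w = cong₂ (λ u′ w′ → u′ ++ᵛ restrict e w′) (take-++ u w) (drop-++ u w)

    restrict-skip-++ : ∀ a {x y} (e : Selection x y) (u : Vec B a) (w : Vec B y) →
      restrict (skip a e) (u ++ᵛ w) ≡ restrict e w
    restrict-skip-++ a e u w = cong (restrict e) (drop-++ u w)

    extend : ∀ {x y} → B → Selection x y → Vec B x → Vec B y
    extend b (done {y}) v = replicate y b
    extend b (keep a e) v = take a v ++ᵛ extend b e (drop a v)
    extend b (skip a e) v = replicate a b ++ᵛ extend b e v

    restrict-extend : ∀ {x y} (b : B) (e : Selection x y) (v : Vec B x) → restrict e (extend b e v) ≡ v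
    restrict-extend b done       []  = refl
    restrict-extend b (keep a e) v = begin
      restrict (keep a e) (take a v ++ᵛ extend b e (drop a v)) ≡⟨ restrict-keep-++ a e (take a v) _ ⟩
      take a v ++ᵛ restrict e (extend b e (drop a v))         ≡⟨ cong (take a v ++ᵛ_) (restrict-extend b e (drop a v)) ⟩
      take a v ++ᵛ drop a v                                   ≡⟨ take++drop≡id a v ⟩
      v                                                       ∎
      where open ≡-Reasoning
    restrict-extend b (skip a e) v = trans (restrict-skip-++ a e (replicate a b) _) (restrict-extend b e v)

  argmax₂ : {X : Set} (f : X → ℕ) (x y : X) → ∃ λ z → f x ≤ f z × f y ≤ f z
  argmax₂ f x y with f x ≤? f y
  ... | yes fx≤fy = y , fx≤fy , ≤-refl
  ... | no  fx≰fy = x , ≤-refl , <⇒≤ (≰⇒> fx≰fy)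

  argmax₃ : {X : Set} (f : X → ℕ) (x y z : X) → ∃ λ m → f x ≤ f m × f y ≤ f m × f z ≤ f m
  argmax₃ f x y z with argmax₂ f x y
  ... | m , fx≤fm , fy≤fm with argmax₂ f m z
  ...   | m′ , fm≤fm′ , fz≤fm′ = m′ , ≤-trans fx≤fm fm≤fm′ , ≤-trans fy≤fm fm≤fm′ , fz≤fm′

  *-self-≤-^ : ∀ {t p s q Q n} → t ≤ p * s → s * s ≤ q ^ n → p ≤ Q → q ≤ Q → t * t ≤ Q ^ (2 + n)
  *-self-≤-^ {t} {p} {s} {q} {Q} {n} t≤ps s²≤qⁿ p≤Q q≤Q = begin
    t * t               ≤⟨ *-mono-≤ t≤ps t≤ps ⟩
    (p * s) * (p * s)   ≡⟨ regroup p s ⟩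
    p * (p * (s * s))   ≤⟨ *-mono-≤ p≤Q (*-mono-≤ p≤Q (≤-trans s²≤qⁿ (^-monoˡ-≤ n q≤Q))) ⟩
    Q * (Q * Q ^ n)     ∎
    where
    open ≤-Reasoning
    regroup : ∀ p s → (p * s) * (p * s) ≡ p * (p * (s * s))
    regroup = solve-∀

  odd≥3 : ℕ → ℕ
  odd≥3 zero    = 3
  odd≥3 (suc j) = 2 + odd≥3 j

  module Shadows {B : Set} (_≟_ : DecidableEquality B) (alphabet : List B) (complete : ∀ b → b ∈ alphabet) where

    vecs : (k : ℕ) → List (Vec B k)
    vecs = allVecs alphabet

    vecs-complete : ∀ {k} (v : Vec B k) → v ∈ vecs k
    vecs-complete = allVecs-complete alphabet complete _

    size : ∀ {k} → (Vec B k → Bool) → ℕ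
    size {k} A = count (vecs k) A

    size-mono : ∀ {k} {A A′ : Vec B k → Bool} → (∀ v → T (A v) → T (A′ v)) → size A ≤ size A′
    size-mono {k} A⊆A′ = ∑-mono (vecs k) (λ v _ → 𝟙-mono (A⊆A′ v))

    size-++ : ∀ a {b} (A : Vec B (a + b) → Bool) → size A ≡ ∑[ u ∈ vecs a ] size (A ∘ (u ++ᵛ_))
    size-++ a {b} A = ∑-allVecs-++ alphabet a b (λ w → 𝟙 (A w))

    lifts : ∀ {x y} → Selection x y → (Vec B y → Bool) → Vec B x → Vec B y → Bool
    lifts e A v w = A w ∧ ⌊ ≡-dec _≟_ (restrict e w) v ⌋

    lifts-intro : ∀ {x y} (e : Selection x y) (A : Vec B y → Bool) {v w} → T (A w) → restrict e w ≡ v → T (lifts e A v w)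
    lifts-intro e A {w = w} Aw refl = Equivalence.from (T-∧ {A w}) (Aw , fromWitness refl)

    lifts-elim : ∀ {x y} (e : Selection x y) (A : Vec B y → Bool) {v w} → T (lifts e A v w) → T (A w) × restrict e w ≡ v
    lifts-elim e A {w = w} h = let Aw , eq = Equivalence.to (T-∧ {A w}) h in Aw , toWitness eq

    shadow : ∀ {x y} → Selection x y → (Vec B y → Bool) → Vec B x → Bool
    shadow {y = y} e A v = any (lifts e A v) (vecs y)

    ∣shadow∣ : ∀ {x y} → Selection x y → (Vec B y → Bool) → ℕ
    ∣shadow∣ e A = size (shadow e A)

    shadow-intro : ∀ {x y} (e : Selection x y) (A : Vec B y → Bool) {w v} → T (A w) → restrict e w ≡ v → T (shadow e A v)
    shadow-intro e A {w} Aw eq = any⁺ _ (lose (vecs-complete w) (lifts-intro e A Aw eq))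

    shadow-elim : ∀ {x y} (e : Selection x y) (A : Vec B y → Bool) {v} → T (shadow e A v) → ∃ λ w → T (A w) × restrict e w ≡ v
    shadow-elim {y = y} e A h = let w , _ , lifted = find (any⁻ _ (vecs y) h) in w , lifts-elim e A lifted

    lift : ∀ {x y} → B → Selection x y → (Vec B y → Bool) → Vec B x → Vec B y
    lift {y = y} b e A v with any? (T? ∘ lifts e A v) (vecs y)
    ... | yes ∃w = proj₁ (find ∃w)
    ... | no  _  = extend b e v

    restrict-lift : ∀ {x y} (b : B) (e : Selection x y) (A : Vec B y → Bool) (v : Vec B x) → restrict e (lift b e A v) ≡ v
    restrict-lift {y = y} b e A v with any? (T? ∘ lifts e A v) (vecs y)
    ... | yes ∃w = proj₂ (lifts-elim e A (proj₂ (proj₂ (find ∃w))))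
    ... | no  _  = restrict-extend b e v

    lift-∈ : ∀ {x y} (b : B) (e : Selection x y) (A : Vec B y → Bool) {v} → T (shadow e A v) → T (A (lift b e A v))
    lift-∈ {y = y} b e A {v} h with any? (T? ∘ lifts e A v) (vecs y)
    ... | yes ∃w = proj₁ (lifts-elim e A (proj₂ (proj₂ (find ∃w))))
    ... | no  ∄w = ⊥-elim (∄w (any⁻ _ (vecs y) h))

    ∣shadow∣-done : ∀ {y} (A : Vec B y → Bool) → 𝟙 (any A (vecs y)) ≤ ∣shadow∣ (done {y}) A
    ∣shadow∣-done {y} A = ≤-trans (𝟙-mono witness) (m≤m+n _ 0)
      where
      witness : T (any A (vecs y)) → T (shadow done A [])
      witness h = let w , _ , Aw = find (any⁻ A (vecs y) h) in shadow-intro done A Aw refl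

    ∣shadow∣-keep : ∀ a {x y} (e : Selection x y) (A : Vec B (a + y) → Bool) →
      ∑[ u ∈ vecs a ] ∣shadow∣ e (A ∘ (u ++ᵛ_)) ≤ ∣shadow∣ (keep a e) A
    ∣shadow∣-keep a {x} e A = begin
      ∑[ u ∈ vecs a ] ∣shadow∣ e (A ∘ (u ++ᵛ_))                           ≤⟨ ∑-mono (vecs a) (λ u _ → size-mono (extend-by u)) ⟩
      ∑[ u ∈ vecs a ] size (shadow (keep a e) A ∘ (u ++ᵛ_))              ≡⟨ size-++ a (shadow (keep a e) A) ⟨
      ∣shadow∣ (keep a e) A                                               ∎
      where
      open ≤-Reasoning
      extend-by : ∀ u v → T (shadow e (A ∘ (u ++ᵛ_)) v) → T (shadow (keep a e) A (u ++ᵛ v))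
      extend-by u v h with shadow-elim e (A ∘ (u ++ᵛ_)) h
      ... | w , Auw , refl = shadow-intro (keep a e) A Auw (restrict-keep-++ a e u w)

    heads : ∀ a {r} → (Vec B (a + r) → Bool) → Vec B a → Bool
    heads a {r} A u = any (λ w → A (u ++ᵛ w)) (vecs r)

    tails : ∀ a {r} → (Vec B (a + r) → Bool) → Vec B r → Bool
    tails a A w = any (λ u → A (u ++ᵛ w)) (vecs a)

    ∣shadow∣-skip : ∀ a {x y} (e : Selection x y) (A : Vec B (a + y) → Bool) → ∣shadow∣ e (tails a A) ≤ ∣shadow∣ (skip a e) A
    ∣shadow∣-skip a e A = size-mono forget-prefix
      where
      forget-prefix : ∀ v → T (shadow e (tails a A) v) → T (shadow (skip a e) A v)
      forget-prefix v h with shadow-elim e _ h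
      ... | w , ∃u , refl = let u , _ , Auw = find (any⁻ _ (vecs a) ∃u) in shadow-intro (skip a e) A Auw (restrict-skip-++ a e u w)

    size-≤-∣shadow∣-keep-done : ∀ a (A : Vec B (a + 0) → Bool) → size A ≤ ∣shadow∣ (keep a done) A
    size-≤-∣shadow∣-keep-done a A = size-mono (λ w Aw → shadow-intro (keep a done) A Aw (restrict-keep-done w))
      where
      restrict-keep-done : (w : Vec B (a + 0)) → restrict (keep a done) w ≡ w
      restrict-keep-done w with drop a w in eq
      ... | [] = trans (cong (take a w ++ᵛ_) (sym eq)) (take++drop≡id a w)

    ∣heads∣-≤-∣shadow∣ : ∀ a {r} (A : Vec B (a + r) → Bool) → size (heads a A) ≤ ∣shadow∣ (keep a (done {r})) A
    ∣heads∣-≤-∣shadow∣ a A = ≤-trans (∑-mono (vecs a) (λ u _ → ∣shadow∣-done (A ∘ (u ++ᵛ_)))) (∣shadow∣-keep a done A)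

    ∑∣heads∣-≤-∣shadow∣ : ∀ a b {r} (A : Vec B (a + (b + r)) → Bool) →
      ∑[ u ∈ vecs a ] size (heads b (A ∘ (u ++ᵛ_))) ≤ ∣shadow∣ (keep a (keep b (done {r}))) A
    ∑∣heads∣-≤-∣shadow∣ a b A =
      ≤-trans (∑-mono (vecs a) (λ u _ → ∣heads∣-≤-∣shadow∣ b (A ∘ (u ++ᵛ_)))) (∣shadow∣-keep a (keep b done) A)

    size-≤-∣heads∣*∣tails∣ : ∀ a {r} (A : Vec B (a + r) → Bool) → size A ≤ size (heads a A) * size (tails a A)
    size-≤-∣heads∣*∣tails∣ a {r} A = begin
      size A                               ≡⟨ size-++ a A ⟩
      ∑[ u ∈ vecs a ] size (A ∘ (u ++ᵛ_))   ≤⟨ count-⊆-× (vecs a) (vecs r) (λ u w → A (u ++ᵛ w)) _ _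
                                                (λ _ w∈ Auw → any⁺ _ (lose w∈ Auw)) (λ u∈ _ Auw → any⁺ (λ u → A (u ++ᵛ _)) (lose u∈ Auw)) ⟩
      size (heads a A) * size (tails a A)  ∎
      where open ≤-Reasoning

    size-≤-∑∣heads∣*∣tails²∣ : ∀ a b {r} (A : Vec B (a + (b + r)) → Bool) →
      size A ≤ (∑[ u ∈ vecs a ] size (heads b (A ∘ (u ++ᵛ_)))) * size (tails b (tails a A))
    size-≤-∑∣heads∣*∣tails²∣ a b A = begin
      size A                                                                    ≡⟨ size-++ a A ⟩
      ∑[ u ∈ vecs a ] size (A ∘ (u ++ᵛ_))                                        ≤⟨ ∑-mono (vecs a) bound ⟩
      ∑[ u ∈ vecs a ] size (heads b (A ∘ (u ++ᵛ_))) * size (tails b (tails a A))  ≡⟨ ∑-*ʳ (vecs a) _ _ ⟩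
      (∑[ u ∈ vecs a ] size (heads b (A ∘ (u ++ᵛ_)))) * size (tails b (tails a A)) ∎
      where
      open ≤-Reasoning
      bound : ∀ u → u ∈ vecs a → size (A ∘ (u ++ᵛ_)) ≤ size (heads b (A ∘ (u ++ᵛ_))) * size (tails b (tails a A))
      bound u _ = ≤-trans (size-≤-∣heads∣*∣tails∣ b (A ∘ (u ++ᵛ_))) (*-monoʳ-≤ (size (heads b (A ∘ (u ++ᵛ_)))) (size-mono (tails-⊆ u)))
        where
        tails-⊆ : ∀ u w → T (tails b (A ∘ (u ++ᵛ_)) w) → T (tails b (tails a A) w)
        tails-⊆ u w h = let v , v∈ , Auvw = find (any⁻ _ (vecs b) h) in
          any⁺ (λ v → tails a A (v ++ᵛ w)) (lose v∈ (any⁺ (λ u → A (u ++ᵛ (v ++ᵛ w))) (lose (vecs-complete u) Auvw)))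

    shearer-blocks : ∀ g m (A : Vec B (suc m * g) → Bool) →
      ∃ λ (e : Selection (g + 0) (suc m * g)) → size A ≤ ∣shadow∣ e A ^ suc m
    shearer-blocks g zero    A = keep g done , ≤-trans (size-≤-∣shadow∣-keep-done g A) (≤-reflexive (sym (*-identityʳ _)))
    shearer-blocks g (suc m) A with shearer-blocks g m (tails g A)
    ... | e′ , ih with argmax₂ (λ e → ∣shadow∣ e A) (keep g done) (skip g e′)
    ...   | e , heads≤ , tails≤ = e , (begin
      size A                                   ≤⟨ size-≤-∣heads∣*∣tails∣ g A ⟩
      size (heads g A) * size (tails g A)      ≤⟨ *-mono-≤ (≤-trans (∣heads∣-≤-∣shadow∣ g A) heads≤) ih ⟩
      ∣shadow∣ e A * ∣shadow∣ e′ (tails g A) ^ suc m ≤⟨ *-monoʳ-≤ (∣shadow∣ e A) (^-monoˡ-≤ (suc m) (≤-trans (∣shadow∣-skip g e′ A) tails≤)) ⟩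
      ∣shadow∣ e A ^ suc (suc m)               ∎)
      where open ≤-Reasoning

    shearer-pairs : ∀ j h (A : Vec B (odd≥3 j * h) → Bool) →
      ∃ λ (e : Selection (h + (h + 0)) (odd≥3 j * h)) → size A * size A ≤ ∣shadow∣ e A ^ odd≥3 j
    shearer-pairs zero h A with argmax₃ (λ e → ∣shadow∣ e A) e₁₂ e₁₃ e₂₃
      where
      e₁₂ e₁₃ e₂₃ : Selection (h + (h + 0)) (h + (h + (h + 0)))
      e₁₂ = keep h (keep h done)
      e₁₃ = keep h (skip h (keep h done))
      e₂₃ = skip h (keep h (keep h done))
    ... | e , ≤₁₂ , ≤₁₃ , ≤₂₃ = e , (begin
      size A * size A    ≡⟨ cong₂ _*_ size≡∣P∣ size≡∣P∣ ⟩
      ∣P∣ * ∣P∣          ≤⟨ loomisWhitney (vecs h) (vecs h) (vecs (h + 0)) P ⟩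
      ∣P₂₃∣ * (∣P₁₂∣ * ∣P₁₃∣) ≤⟨ *-mono-≤ (≤-trans ∣P₂₃∣≤ ≤₂₃) (*-mono-≤ (≤-trans ∣P₁₂∣≤ ≤₁₂) (≤-trans ∣P₁₃∣≤ ≤₁₃)) ⟩
      Q * (Q * Q)        ≡⟨ cong (λ z → Q * (Q * z)) (sym (*-identityʳ Q)) ⟩
      Q ^ 3              ∎)
      where
      open ≤-Reasoning
      Q = ∣shadow∣ e A
      P : Vec B h → Vec B h → Vec B (h + 0) → Bool
      P u v w = A (u ++ᵛ (v ++ᵛ w))
      ∣P∣   = ∑[ u ∈ vecs h ] ∑[ v ∈ vecs h ] count (vecs (h + 0)) (P u v)
      ∣P₁₂∣ = ∑[ u ∈ vecs h ] count (vecs h) (λ v → any (P u v) (vecs (h + 0)))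
      ∣P₁₃∣ = ∑[ u ∈ vecs h ] count (vecs (h + 0)) (λ w → any (λ v → P u v w) (vecs h))
      ∣P₂₃∣ = ∑[ v ∈ vecs h ] count (vecs (h + 0)) (λ w → any (λ u → P u v w) (vecs h))
      size≡∣P∣ : size A ≡ ∣P∣
      size≡∣P∣ = trans (size-++ h A) (∑-cong (vecs h) (λ u _ → size-++ h (A ∘ (u ++ᵛ_))))
      ∣P₁₂∣≤ : ∣P₁₂∣ ≤ ∣shadow∣ (keep h (keep h done)) A
      ∣P₁₂∣≤ = ∑∣heads∣-≤-∣shadow∣ h h A
      ∣P₁₃∣≤ : ∣P₁₃∣ ≤ ∣shadow∣ (keep h (skip h (keep h done))) A
      ∣P₁₃∣≤ = ≤-trans
        (∑-mono (vecs h) (λ u _ → ≤-trans (size-≤-∣shadow∣-keep-done h (tails h (A ∘ (u ++ᵛ_)))) (∣shadow∣-skip h (keep h done) (A ∘ (u ++ᵛ_)))))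
        (∣shadow∣-keep h (skip h (keep h done)) A)
      ∣P₂₃∣≤ : ∣P₂₃∣ ≤ ∣shadow∣ (skip h (keep h (keep h done))) A
      ∣P₂₃∣≤ = ≤-trans
        (∑-mono (vecs h) (λ v _ → size-≤-∣shadow∣-keep-done h (tails h A ∘ (v ++ᵛ_))))
        (≤-trans (∣shadow∣-keep h (keep h done) (tails h A)) (∣shadow∣-skip h (keep h (keep h done)) A))
    shearer-pairs (suc j) h A with shearer-pairs j h (tails h (tails h A))
    ... | e′ , ih with argmax₂ (λ e → ∣shadow∣ e A) (keep h (keep h done)) (skip h (skip h e′))
    ...   | e , heads≤ , tails≤ = e , *-self-≤-^ {n = odd≥3 j} (size-≤-∑∣heads∣*∣tails²∣ h h A) ih
        (≤-trans (∑∣heads∣-≤-∣shadow∣ h h A) heads≤)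
        (≤-trans (≤-trans (∣shadow∣-skip h e′ (tails h A)) (∣shadow∣-skip h (skip h e′) A)) tails≤)

  length-filter : {A : Set} {P : A → Set} (P? : ∀ x → Dec (P x)) (xs : List A) → length (filter P? xs) ≡ count xs (λ x → ⌊ P? x ⌋)
  length-filter P? []       = refl
  length-filter P? (x ∷ xs) with P? x
  ... | yes _ = cong suc (length-filter P? xs)
  ... | no  _ = length-filter P? xs

  ^-distribʳ-* : ∀ a b o → (a * b) ^ o ≡ a ^ o * b ^ o
  ^-distribʳ-* a b zero    = refl
  ^-distribʳ-* a b (suc o) = trans (cong (a * b *_) (^-distribʳ-* a b o)) (interchange a b (a ^ o) (b ^ o))
    where
    interchange : ∀ a b x y → a * b * (x * y) ≡ a * x * (b * y)
    interchange = solve-∀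

  raise-fibre-bound : ∀ {C p c} n t g ℓ → p ≤ C → c ^ g ≤ p ^ ℓ → (2 ^ n) ^ ℓ ≤ c * 2 ^ t →
    (2 ^ (n * g)) ^ ℓ ≤ C ^ ℓ * 2 ^ (t * g)
  raise-fibre-bound {C} {p} {c} n t g ℓ p≤C cᵍ≤pˡ fibre≥ = begin
    (2 ^ (n * g)) ^ ℓ   ≡⟨ cong (_^ ℓ) (^-*-assoc 2 n g) ⟨
    ((2 ^ n) ^ g) ^ ℓ   ≡⟨ ^-*-assoc (2 ^ n) g ℓ ⟩
    (2 ^ n) ^ (g * ℓ)   ≡⟨ cong ((2 ^ n) ^_) (*-comm g ℓ) ⟩
    (2 ^ n) ^ (ℓ * g)   ≡⟨ ^-*-assoc (2 ^ n) ℓ g ⟨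
    ((2 ^ n) ^ ℓ) ^ g   ≤⟨ ^-monoˡ-≤ g fibre≥ ⟩
    (c * 2 ^ t) ^ g     ≡⟨ ^-distribʳ-* c (2 ^ t) g ⟩
    c ^ g * (2 ^ t) ^ g ≤⟨ *-monoˡ-≤ _ (≤-trans cᵍ≤pˡ (^-monoˡ-≤ ℓ p≤C)) ⟩
    C ^ ℓ * (2 ^ t) ^ g ≡⟨ cong (C ^ ℓ *_) (^-*-assoc 2 t g) ⟩
    C ^ ℓ * 2 ^ (t * g) ∎
    where open ≤-Reasoning

  -- Clearing denominators, Pr[f(X) = z]^ℓ ≥ 2^{-tg}.
  HeavyOutput : (g ℓ n t : ℕ) → (Vec (Bits n) ℓ → Bits t) → Set
  HeavyOutput g ℓ n t f = ∃ λ (X : NOSF g ℓ n) → ∃ λ z → (2 ^ (n * NOSF.k X)) ^ ℓ ≤ countPre X f z ^ ℓ * 2 ^ (t * g)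

  bits-complete : ∀ {m} (b : Bits m) → b ∈ allBits m
  bits-complete {m} = allVecs-complete _ (λ { false → here refl ; true → there (here refl) }) m

  module _ {n : ℕ} where

    open Shadows (≡-dec _≟ᵇ_) (allBits n) bits-complete

    source : ∀ {g k ℓ} → g ≤ k → Selection k ℓ → (Vec (Bits n) ℓ → Bool) → NOSF g ℓ n
    source {k = k} g≤k e A = record
      { k       = k
      ; g≤k     = g≤k
      ; pos     = position e
      ; pos-inj = position-injective e
      ; src     = lift (replicate n false) e A
      ; good    = λ y j → trans (sym (lookup-restrict e _ j)) (cong (λ v → lookup v j) (restrict-lift _ e A y))
      }

    fibre : ∀ {ℓ t} → (Vec (Bits n) ℓ → Bits t) → Bits t → Vec (Bits n) ℓ → Bool
    fibre f z w = ⌊ ≡-dec _≟ᵇ_ (f w) z ⌋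

    ∣shadow∣-≤-countPre : ∀ {g k ℓ t} (g≤k : g ≤ k) (e : Selection k ℓ) (f : Vec (Bits n) ℓ → Bits t) (z : Bits t) →
      ∣shadow∣ e (fibre f z) ≤ countPre (source g≤k e (fibre f z)) f z
    ∣shadow∣-≤-countPre {k = k} g≤k e f z =
      ≤-trans (size-mono (λ y → lift-∈ (replicate n false) e (fibre f z) {y}))
              (≤-reflexive (sym (length-filter (λ y → ≡-dec _≟ᵇ_ (f (lift (replicate n false) e (fibre f z) y)) z) (vecs k))))

    pigeonhole : ∀ {ℓ t} (f : Vec (Bits n) ℓ → Bits t) → ∃ λ z → (2 ^ n) ^ ℓ ≤ size (fibre f z) * 2 ^ t
    pigeonhole {ℓ} {t} f with ∑-≤-length*maximum (allBits t) (λ z → size (fibre f z)) (replicate t false)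
    ... | z , maximal = z , (begin
      (2 ^ n) ^ ℓ                                   ≡⟨ cong (_^ ℓ) (length-allVecs _ n) ⟨
      length (allBits n) ^ ℓ                        ≡⟨ length-allVecs (allBits n) ℓ ⟨
      length (vecs ℓ)                               ≡⟨ trans (sym (*-identityʳ _)) (sym (∑-const (vecs ℓ) 1)) ⟩
      ∑[ w ∈ vecs ℓ ] 1                              ≤⟨ ∑-mono (vecs ℓ) (λ w _ → ≤-trans (𝟙-mono (λ _ → fromWitness refl)) (∑-≥-member (allBits t) (λ z → 𝟙 (fibre f z w)) (bits-complete (f w)))) ⟩
      ∑[ w ∈ vecs ℓ ] count (allBits t) (λ z → fibre f z w) ≡⟨ ∑-comm (vecs ℓ) (allBits t) (λ w z → 𝟙 (fibre f z w)) ⟩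
      ∑[ z ∈ allBits t ] size (fibre f z)           ≤⟨ maximal ⟩
      length (allBits t) * size (fibre f z)         ≡⟨ cong (_* size (fibre f z)) (length-allVecs _ t) ⟩
      2 ^ t * size (fibre f z)                      ≡⟨ *-comm (2 ^ t) _ ⟩
      size (fibre f z) * 2 ^ t                      ∎)
      where open ≤-Reasoning

    heavyOutput : ∀ {g k ℓ t} (f : Vec (Bits n) ℓ → Bits t) (z : Bits t) (e : Selection k ℓ) → k ≡ g →
      (2 ^ n) ^ ℓ ≤ size (fibre f z) * 2 ^ t → size (fibre f z) ^ g ≤ ∣shadow∣ e (fibre f z) ^ ℓ → HeavyOutput g ℓ n t f
    heavyOutput {g} {ℓ = ℓ} {t} f z e refl fibre≥ fibreᵍ≤ =
      source ≤-refl e (fibre f z) , z , raise-fibre-bound n t g ℓ (∣shadow∣-≤-countPre ≤-refl e f z) fibreᵍ≤ fibre≥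

    heavyOutput-blocks : ∀ g m {t} (f : Vec (Bits n) (suc m * g) → Bits t) → HeavyOutput g (suc m * g) n t f
    heavyOutput-blocks g m f with pigeonhole f
    ... | z , fibre≥ with shearer-blocks g m (fibre f z)
    ...   | e , shearer = heavyOutput f z e (+-identityʳ g) fibre≥
      (≤-trans (^-monoˡ-≤ g shearer) (≤-reflexive (^-*-assoc _ (suc m) g)))

    heavyOutput-pairs : ∀ j h {t} (f : Vec (Bits n) (odd≥3 j * h) → Bits t) → HeavyOutput (2 * h) (odd≥3 j * h) n t f
    heavyOutput-pairs j h f with pigeonhole f
    ... | z , fibre≥ with shearer-pairs j h (fibre f z)
    ...   | e , shearer = heavyOutput f z e refl fibre≥ (begin
      c ^ (2 * h)                    ≡⟨ ^-*-assoc c 2 h ⟨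
      (c * (c * 1)) ^ h              ≡⟨ cong (λ c² → (c * c²) ^ h) (*-identityʳ c) ⟩
      (c * c) ^ h                    ≤⟨ ^-monoˡ-≤ h shearer ⟩
      (∣shadow∣ e (fibre f z) ^ odd≥3 j) ^ h ≡⟨ ^-*-assoc _ (odd≥3 j) h ⟩
      ∣shadow∣ e (fibre f z) ^ (odd≥3 j * h) ∎)
      where
      open ≤-Reasoning
      c = size (fibre f z)

  data Shape (g ℓ : ℕ) : Set where
    blocks : ∀ m → ℓ ≡ suc m * g → Shape g ℓ
    pairs  : ∀ j h → g ≡ 2 * h → ℓ ≡ odd≥3 j * h → Shape g ℓ

  even-or-odd : ∀ c → ∃ λ M → c ≡ 2 * M ⊎ c ≡ suc (2 * M)
  even-or-odd zero    = 0 , inj₁ refl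
  even-or-odd (suc c) with even-or-odd c
  ... | M , inj₁ refl = M , inj₂ refl
  ... | M , inj₂ refl = suc M , inj₁ (cong suc (sym (+-suc M (M + 0))))

  odd≥3≡ : ∀ j → odd≥3 j ≡ suc (2 * suc j)
  odd≥3≡ zero    = refl
  odd≥3≡ (suc j) = trans (cong (2 +_) (odd≥3≡ j)) (cong (2 +_) (sym (+-suc (suc j) (suc j + 0))))

  shape : ∀ g ℓ .{{_ : NonZero g}} → g ≤ ℓ → (∃ λ c → g * c ≡ 2 * ℓ) → Shape g ℓ
  shape g ℓ g≤ℓ (c , gc≡2ℓ) with even-or-odd c
  ... | M , inj₁ refl with M
  ...   | zero  = ⊥-elim (≢-nonZero⁻¹ g (n≤0⇒n≡0 (≤-trans g≤ℓ (≤-reflexive ℓ≡0))))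
    where
    ℓ≡0 : ℓ ≡ 0
    ℓ≡0 = *-cancelˡ-≡ ℓ 0 2 (trans (sym gc≡2ℓ) (*-zeroʳ g))
  ...   | suc m = blocks m (*-cancelˡ-≡ ℓ _ 2 (trans (sym gc≡2ℓ) (regroup g m)))
    where
    regroup : ∀ g m → g * (2 * suc m) ≡ 2 * (suc m * g)
    regroup = solve-∀
  shape g ℓ g≤ℓ (c , gc≡2ℓ) | M , inj₂ refl with even-or-odd g
  ... | h , inj₂ g≡1+2h = ⊥-elim (even≢odd ℓ (h + M + 2 * (h * M)) (trans (sym gc≡2ℓ) (trans (cong (_* suc (2 * M)) g≡1+2h) (regroup h M))))
    where
    regroup : ∀ h M → suc (2 * h) * suc (2 * M) ≡ suc (2 * (h + M + 2 * (h * M)))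
    regroup = solve-∀
  ... | h , inj₁ g≡2h with M
  ...   | zero  = ⊥-elim (≢-nonZero⁻¹ g (trans g≡2h (cong (2 *_) h≡0)))
    where
    ℓ≡h : ℓ ≡ h
    ℓ≡h = *-cancelˡ-≡ ℓ h 2 (trans (sym gc≡2ℓ) (trans (cong (_* 1) g≡2h) (*-identityʳ (2 * h))))
    h≡0 : h ≡ 0
    h≡0 = n≤0⇒n≡0 (+-cancelˡ-≤ h h 0
      (subst₂ _≤_ (trans g≡2h (cong (h +_) (+-identityʳ h))) (trans ℓ≡h (sym (+-identityʳ h))) g≤ℓ))
  ...   | suc j = pairs j h g≡2h (*-cancelˡ-≡ ℓ _ 2 (trans (sym gc≡2ℓ) (trans (cong (_* suc (2 * suc j)) g≡2h) (trans (regroup h j) (cong (λ o → 2 * (o * h)) (sym (odd≥3≡ j)))))))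
    where
    regroup : ∀ h j → 2 * h * suc (2 * suc j) ≡ 2 * (suc (2 * suc j) * h)
    regroup = solve-∀

  heavyOutput-exists : ∀ {g ℓ} .{{_ : NonZero g}} → g ≤ ℓ → (∃ λ c → g * c ≡ 2 * ℓ) →
    ∀ {n t} (f : Vec (Bits n) ℓ → Bits t) → HeavyOutput g ℓ n t f
  heavyOutput-exists {g} {ℓ} g≤ℓ g∣2ℓ with shape g ℓ g≤ℓ g∣2ℓ
  ... | blocks m refl      = heavyOutput-blocks g m
  ... | pairs j h refl refl = heavyOutput-pairs j h

  -- N/D will be g t/ℓ + 1 in lowest terms.
  rescale-exponent : ∀ {C m t g ℓ} N D .{{_ : NonZero ℓ}} → (2 ^ m) ^ ℓ ≤ C ^ ℓ * 2 ^ (t * g) → N * ℓ ≡ (g * t + ℓ) * D →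
    (2 ^ m) ^ D ≤ C ^ D * 2 ^ N
  rescale-exponent {C} {m} {t} {g} {ℓ} N D bound N*ℓ≡ = ^-cancelʳ-≤ ℓ (begin
    ((2 ^ m) ^ D) ^ ℓ                 ≡⟨ swap-exponents (2 ^ m) D ℓ ⟩
    ((2 ^ m) ^ ℓ) ^ D                 ≤⟨ ^-monoˡ-≤ D bound ⟩
    (C ^ ℓ * 2 ^ (t * g)) ^ D         ≡⟨ ^-distribʳ-* (C ^ ℓ) (2 ^ (t * g)) D ⟩
    (C ^ ℓ) ^ D * (2 ^ (t * g)) ^ D   ≡⟨ cong₂ _*_ (swap-exponents C ℓ D) (^-*-assoc 2 (t * g) D) ⟩
    (C ^ D) ^ ℓ * 2 ^ (t * g * D)     ≤⟨ *-monoʳ-≤ ((C ^ D) ^ ℓ) (^-monoʳ-≤ 2 tgD≤Nℓ) ⟩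
    (C ^ D) ^ ℓ * 2 ^ (N * ℓ)         ≡⟨ cong ((C ^ D) ^ ℓ *_) (^-*-assoc 2 N ℓ) ⟨
    (C ^ D) ^ ℓ * (2 ^ N) ^ ℓ         ≡⟨ ^-distribʳ-* (C ^ D) (2 ^ N) ℓ ⟨
    (C ^ D * 2 ^ N) ^ ℓ               ∎)
    where
    open ≤-Reasoning
    swap-exponents : ∀ x i j → (x ^ i) ^ j ≡ (x ^ j) ^ i
    swap-exponents x i j = trans (^-*-assoc x i j) (trans (cong (x ^_) (*-comm i j)) (sym (^-*-assoc x j i)))
    tgD≤Nℓ : t * g * D ≤ N * ℓ
    tgD≤Nℓ = begin
      t * g * D             ≡⟨ cong (_* D) (*-comm t g) ⟩
      g * t * D             ≤⟨ m≤m+n _ _ ⟩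
      g * t * D + ℓ * D     ≡⟨ *-distribʳ-+ D (g * t) ℓ ⟨
      (g * t + ℓ) * D       ≡⟨ N*ℓ≡ ⟨
      N * ℓ                 ∎

module MinEntropy where

  open import Data.Nat as ℕ using (ℕ; zero; suc; NonZero)
  import Data.Nat.Properties as ℕP
  open import Data.Integer.GCD using (gcd)
  open import Data.Integer as ℤ using (+_; -[1+_]; +[1+_])
  import Data.Integer.Properties as ℤP
  open import Data.Integer.Tactic.RingSolver using (solve-∀)
  open import Data.Rational as ℚ using (ℚ; mkℚ; toℚᵘ; ½; 1ℚ)
  import Data.Rational.Properties as ℚP
  open import Data.Rational.Unnormalised as ℚᵘ using (ℚᵘ; mkℚᵘ; *≡*; *≤*)
  open import Relation.Binary.PropositionalEquality
  open import Relation.Nullary using (contradiction)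
  open import Defs using (_^ℚ_; TwoPowNegLe)
  open Combinatorics using (^-cancelʳ-≤; rescale-exponent)

  record IsRatio (x : ℚᵘ) (a b : ℕ) : Set where
    constructor ratio
    field cross : ℚᵘ.↥ x ℤ.* + b ≡ + a ℤ.* ℚᵘ.↧ x

  isRatio-resp-≃ : ∀ {x y a b} → x ℚᵘ.≃ y → IsRatio y a b → IsRatio x a b
  isRatio-resp-≃ {mkℚᵘ p q} {mkℚᵘ r s} {a} {b} (*≡* ps≡rq) (ratio r/s≡a/b) = ratio (ℤP.*-cancelʳ-≡ _ _ (+ suc s) (begin
    p ℤ.* + b ℤ.* + suc s         ≡⟨ swap p (+ b) (+ suc s) ⟩
    p ℤ.* + suc s ℤ.* + b         ≡⟨ cong (ℤ._* + b) ps≡rq ⟩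
    r ℤ.* + suc q ℤ.* + b         ≡⟨ swap r (+ suc q) (+ b) ⟩
    r ℤ.* + b ℤ.* + suc q         ≡⟨ cong (ℤ._* + suc q) r/s≡a/b ⟩
    + a ℤ.* + suc s ℤ.* + suc q   ≡⟨ swap (+ a) (+ suc s) (+ suc q) ⟩
    + a ℤ.* + suc q ℤ.* + suc s   ∎))
    where
    open ≡-Reasoning
    swap : ∀ x y z → x ℤ.* y ℤ.* z ≡ x ℤ.* z ℤ.* y
    swap = solve-∀

  isRatio-*ᵘ : ∀ {x y a b c d} → IsRatio x a b → IsRatio y c d → IsRatio (x ℚᵘ.* y) (a ℕ.* c) (b ℕ.* d)
  isRatio-*ᵘ {mkℚᵘ p q} {mkℚᵘ r s} {a} {b} {c} {d} (ratio p/q≡a/b) (ratio r/s≡c/d) = ratio (begin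
    (p ℤ.* r) ℤ.* + (b ℕ.* d)                 ≡⟨ cong ((p ℤ.* r) ℤ.*_) (ℤP.pos-* b d) ⟩
    (p ℤ.* r) ℤ.* (+ b ℤ.* + d)             ≡⟨ interchange p r (+ b) (+ d) ⟩
    (p ℤ.* + b) ℤ.* (r ℤ.* + d)             ≡⟨ cong₂ ℤ._*_ p/q≡a/b r/s≡c/d ⟩
    (+ a ℤ.* + suc q) ℤ.* (+ c ℤ.* + suc s) ≡⟨ interchange (+ a) (+ suc q) (+ c) (+ suc s) ⟩
    (+ a ℤ.* + c) ℤ.* (+ suc q ℤ.* + suc s) ≡⟨ cong₂ ℤ._*_ (ℤP.pos-* a c) (ℤP.pos-* (suc q) (suc s)) ⟨
    + (a ℕ.* c) ℤ.* + (suc q ℕ.* suc s)         ∎)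
    where
    open ≡-Reasoning
    interchange : ∀ w x y z → (w ℤ.* x) ℤ.* (y ℤ.* z) ≡ (w ℤ.* y) ℤ.* (x ℤ.* z)
    interchange = solve-∀

  isRatio-+ᵘ : ∀ {x y a b c d} → IsRatio x a b → IsRatio y c d → IsRatio (x ℚᵘ.+ y) (a ℕ.* d ℕ.+ c ℕ.* b) (b ℕ.* d)
  isRatio-+ᵘ {mkℚᵘ p q} {mkℚᵘ r s} {a} {b} {c} {d} (ratio p/q≡a/b) (ratio r/s≡c/d) = ratio (begin
    (p ℤ.* S ℤ.+ r ℤ.* Q) ℤ.* + (b ℕ.* d)                    ≡⟨ cong ((p ℤ.* S ℤ.+ r ℤ.* Q) ℤ.*_) (ℤP.pos-* b d) ⟩
    (p ℤ.* S ℤ.+ r ℤ.* Q) ℤ.* (+ b ℤ.* + d)                ≡⟨ expand p r Q S (+ b) (+ d) ⟩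
    (p ℤ.* + b) ℤ.* (S ℤ.* + d) ℤ.+ (r ℤ.* + d) ℤ.* (Q ℤ.* + b) ≡⟨ cong₂ (λ u v → u ℤ.* (S ℤ.* + d) ℤ.+ v ℤ.* (Q ℤ.* + b)) p/q≡a/b r/s≡c/d ⟩
    (+ a ℤ.* Q) ℤ.* (S ℤ.* + d) ℤ.+ (+ c ℤ.* S) ℤ.* (Q ℤ.* + b) ≡⟨ collect (+ a) (+ c) Q S (+ b) (+ d) ⟩
    (+ a ℤ.* + d ℤ.+ + c ℤ.* + b) ℤ.* (Q ℤ.* S)            ≡⟨ cong₂ ℤ._*_ (cong₂ ℤ._+_ (ℤP.pos-* a d) (ℤP.pos-* c b)) (ℤP.pos-* (suc q) (suc s)) ⟨
    + (a ℕ.* d ℕ.+ c ℕ.* b) ℤ.* + (suc q ℕ.* suc s)                ∎)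
    where
    open ≡-Reasoning
    Q = + suc q
    S = + suc s
    expand : ∀ p r Q S b d → (p ℤ.* S ℤ.+ r ℤ.* Q) ℤ.* (b ℤ.* d) ≡ (p ℤ.* b) ℤ.* (S ℤ.* d) ℤ.+ (r ℤ.* d) ℤ.* (Q ℤ.* b)
    expand = solve-∀
    collect : ∀ a c Q S b d → (a ℤ.* Q) ℤ.* (S ℤ.* d) ℤ.+ (c ℤ.* S) ℤ.* (Q ℤ.* b) ≡ (a ℤ.* d ℤ.+ c ℤ.* b) ℤ.* (Q ℤ.* S)
    collect = solve-∀

  isRatio-≤ᵘ : ∀ {x y a b c d} .{{_ : NonZero b}} .{{_ : NonZero d}} → IsRatio x a b → IsRatio y c d → a ℕ.* d ℕ.≤ c ℕ.* b → x ℚᵘ.≤ y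
  isRatio-≤ᵘ {b = zero} {{b≢0}} = contradiction refl (ℕ.≢-nonZero⁻¹ 0 {{b≢0}})
  isRatio-≤ᵘ {d = zero} {{_}} {{d≢0}} = contradiction refl (ℕ.≢-nonZero⁻¹ 0 {{d≢0}})
  isRatio-≤ᵘ {mkℚᵘ p q} {mkℚᵘ r s} {a} {suc b} {c} {suc d} (ratio p/q≡a/b) (ratio r/s≡c/d) ad≤cb = *≤* (ℤP.*-cancelʳ-≤-pos _ _ (B ℤ.* D) (begin
    p ℤ.* S ℤ.* (B ℤ.* D)        ≡⟨ shuffle₁ p S B D ⟩
    (p ℤ.* B) ℤ.* (S ℤ.* D)      ≡⟨ cong (ℤ._* (S ℤ.* D)) p/q≡a/b ⟩
    (+ a ℤ.* Q) ℤ.* (S ℤ.* D)    ≡⟨ shuffle₂ (+ a) Q S D ⟩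
    (+ a ℤ.* D) ℤ.* (Q ℤ.* S)    ≤⟨ ℤP.*-monoʳ-≤-nonNeg (Q ℤ.* S) aD≤cB ⟩
    (+ c ℤ.* B) ℤ.* (Q ℤ.* S)    ≡⟨ shuffle₃ (+ c) S Q B ⟨
    (+ c ℤ.* S) ℤ.* (Q ℤ.* B)    ≡⟨ cong (ℤ._* (Q ℤ.* B)) r/s≡c/d ⟨
    (r ℤ.* D) ℤ.* (Q ℤ.* B)      ≡⟨ shuffle₄ r Q B D ⟩
    r ℤ.* Q ℤ.* (B ℤ.* D)        ∎))
    where
    open ℤP.≤-Reasoning
    B = + suc b
    D = + suc d
    Q = + suc q
    S = + suc s
    aD≤cB : + a ℤ.* D ℤ.≤ + c ℤ.* B
    aD≤cB = subst₂ ℤ._≤_ (ℤP.pos-* a (suc d)) (ℤP.pos-* c (suc b)) (ℤ.+≤+ ad≤cb)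
    shuffle₁ : ∀ p S B D → p ℤ.* S ℤ.* (B ℤ.* D) ≡ (p ℤ.* B) ℤ.* (S ℤ.* D)
    shuffle₁ = solve-∀
    shuffle₂ : ∀ a Q S D → (a ℤ.* Q) ℤ.* (S ℤ.* D) ≡ (a ℤ.* D) ℤ.* (Q ℤ.* S)
    shuffle₂ = solve-∀
    shuffle₃ : ∀ c S Q B → (c ℤ.* S) ℤ.* (Q ℤ.* B) ≡ (c ℤ.* B) ℤ.* (Q ℤ.* S)
    shuffle₃ = solve-∀
    shuffle₄ : ∀ r Q B D → (r ℤ.* D) ℤ.* (Q ℤ.* B) ≡ r ℤ.* Q ℤ.* (B ℤ.* D)
    shuffle₄ = solve-∀

  isRatio-resp-≡ : ∀ {x a b a′ b′} → a ≡ a′ → b ≡ b′ → IsRatio x a b → IsRatio x a′ b′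
  isRatio-resp-≡ {x} = subst₂ (IsRatio x)

  isRatio-/ : ∀ a b .{{_ : NonZero b}} → IsRatio (toℚᵘ (+ a ℚ./ b)) a b
  isRatio-/ a b = from-ℚ (+ a ℚ./ b) (begin
    ↥q ℤ.* + b             ≡⟨ cong (↥q ℤ.*_) (ℚP.↧-/ (+ a) b) ⟨
    ↥q ℤ.* (↧q ℤ.* G)      ≡⟨ rearrange ↥q ↧q G ⟩
    (↥q ℤ.* G) ℤ.* ↧q      ≡⟨ cong (ℤ._* ↧q) (ℚP.↥-/ (+ a) b) ⟩
    + a ℤ.* ↧q             ∎)
    where
    open ≡-Reasoning
    ↥q = ℚ.↥ (+ a ℚ./ b)
    ↧q = ℚ.↧ (+ a ℚ./ b)
    G = gcd (+ a) (+ b)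
    rearrange : ∀ x y z → x ℤ.* (y ℤ.* z) ≡ (x ℤ.* z) ℤ.* y
    rearrange = solve-∀
    from-ℚ : ∀ q → ℚ.↥ q ℤ.* + b ≡ + a ℤ.* ℚ.↧ q → IsRatio (toℚᵘ q) a b
    from-ℚ (mkℚ _ _ _) eq = ratio eq

  isRatio-* : ∀ p q {a b c d} → IsRatio (toℚᵘ p) a b → IsRatio (toℚᵘ q) c d → IsRatio (toℚᵘ (p ℚ.* q)) (a ℕ.* c) (b ℕ.* d)
  isRatio-* p q p≐ q≐ = isRatio-resp-≃ (ℚP.toℚᵘ-homo-* p q) (isRatio-*ᵘ p≐ q≐)

  isRatio-+ : ∀ p q {a b c d} → IsRatio (toℚᵘ p) a b → IsRatio (toℚᵘ q) c d → IsRatio (toℚᵘ (p ℚ.+ q)) (a ℕ.* d ℕ.+ c ℕ.* b) (b ℕ.* d)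
  isRatio-+ p q p≐ q≐ = isRatio-resp-≃ (ℚP.toℚᵘ-homo-+ p q) (isRatio-+ᵘ p≐ q≐)

  isRatio-^ : ∀ q {a b} → IsRatio (toℚᵘ q) a b → ∀ k → IsRatio (toℚᵘ (q ^ℚ k)) (a ℕ.^ k) (b ℕ.^ k)
  isRatio-^ q q≐ zero    = isRatio-/ 1 1
  isRatio-^ q {a} {b} q≐ (suc k) = isRatio-* q (q ^ℚ k) {a} {b} {a ℕ.^ k} {b ℕ.^ k} q≐ (isRatio-^ q q≐ k)

  -- TwoPowNegLe a p reads 2^{-N} ≤ p^D for the lowest terms N/D of a, which need not be computed: any N/D = G/L will do.
  twoPowNegLe-from-ratios : ∀ (a p : ℚ) {G L c d} .{{_ : NonZero G}} .{{_ : NonZero L}} .{{_ : NonZero d}} →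
    IsRatio (toℚᵘ a) G L → IsRatio (toℚᵘ p) c d →
    (∀ N D → N ℕ.* L ≡ G ℕ.* D → d ℕ.^ D ℕ.≤ c ℕ.^ D ℕ.* 2 ℕ.^ N) → TwoPowNegLe a p
  twoPowNegLe-from-ratios (mkℚ (+ zero) D-1 _) p {G} a≐ p≐ bound =
    contradiction (sym (ℤP.+-injective (trans (IsRatio.cross a≐) (sym (ℤP.pos-* G (suc D-1)))))) (ℕ.≢-nonZero⁻¹ _ {{ℕP.m*n≢0 G (suc D-1)}})
  twoPowNegLe-from-ratios (mkℚ -[1+ _ ] D-1 _) p {G} {suc L-1} a≐ p≐ bound with trans (IsRatio.cross a≐) (sym (ℤP.pos-* G (suc D-1)))
  ... | ()
  twoPowNegLe-from-ratios (mkℚ +[1+ N-1 ] D-1 _) p {G} {L} {c} {d} a≐ p≐ bound =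
    ℚP.toℚᵘ-cancel-≤ (isRatio-≤ᵘ {a = 1 ℕ.^ N} {2 ℕ.^ N} {c ℕ.^ D} {d ℕ.^ D} {{ℕP.m^n≢0 2 N}} {{ℕP.m^n≢0 d D}}
      (isRatio-^ ½ {1} {2} (isRatio-/ 1 2) N) (isRatio-^ p {c} {d} p≐ D) ratio-bound)
    where
    N = suc N-1
    D = suc D-1
    ratio-bound : 1 ℕ.^ N ℕ.* d ℕ.^ D ℕ.≤ c ℕ.^ D ℕ.* 2 ℕ.^ N
    ratio-bound = subst (ℕ._≤ c ℕ.^ D ℕ.* 2 ℕ.^ N) (trans (sym (ℕP.*-identityˡ _)) (cong (ℕ._* d ℕ.^ D) (sym (ℕP.^-zeroˡ N))))
      (bound N D (ℤP.+-injective (trans (ℤP.pos-* N L) (trans (IsRatio.cross a≐) (sym (ℤP.pos-* G D))))))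
  twoPowNegLe-from-ratios (mkℚ -[1+ _ ] D-1 _) p {G} {zero} {{_}} {{L≢0}} = contradiction refl (ℕ.≢-nonZero⁻¹ 0 {{L≢0}})

  twoPowNegLe-of-counts : ∀ C m t g ℓ .{{ℓ≢0 : NonZero ℓ}} → (2 ℕ.^ m) ℕ.^ ℓ ℕ.≤ C ℕ.^ ℓ ℕ.* 2 ℕ.^ (t ℕ.* g) →
    TwoPowNegLe (((+ g ℚ./ ℓ) ℚ.* (+ t ℚ./ 1)) ℚ.+ 1ℚ) ((+ C ℚ./ 1) ℚ.* (½ ^ℚ m))
  twoPowNegLe-of-counts C m t g ℓ {{ℓ≢0}} bound =
    twoPowNegLe-from-ratios _ _ {{gt+ℓ≢0}} {{ℓ≢0}} {{ℕP.m^n≢0 2 m}} a≐ p≐ (λ N D eq → rescale-exponent {m = m} {t} {g} N D bound eq)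
    where
    gt+ℓ≢0 : NonZero (g ℕ.* t ℕ.+ ℓ)
    gt+ℓ≢0 = ℕ.>-nonZero (ℕP.<-≤-trans (ℕP.n≢0⇒n>0 (ℕ.≢-nonZero⁻¹ ℓ)) (ℕP.m≤n+m ℓ (g ℕ.* t)))
    a≐ : IsRatio (toℚᵘ (((+ g ℚ./ ℓ) ℚ.* (+ t ℚ./ 1)) ℚ.+ 1ℚ)) (g ℕ.* t ℕ.+ ℓ) ℓ
    a≐ = isRatio-resp-≡
      (cong₂ ℕ._+_ (ℕP.*-identityʳ (g ℕ.* t)) (trans (ℕP.*-identityˡ (ℓ ℕ.* 1)) (ℕP.*-identityʳ ℓ)))
      (trans (ℕP.*-identityʳ (ℓ ℕ.* 1)) (ℕP.*-identityʳ ℓ))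
      (isRatio-+ _ _ (isRatio-* _ _ (isRatio-/ g ℓ) (isRatio-/ t 1)) (isRatio-/ 1 1))
    p≐ : IsRatio (toℚᵘ ((+ C ℚ./ 1) ℚ.* (½ ^ℚ m))) C (2 ℕ.^ m)
    p≐ = isRatio-resp-≡
      (trans (cong (C ℕ.*_) (ℕP.^-zeroˡ m)) (ℕP.*-identityʳ C))
      (ℕP.*-identityˡ (2 ℕ.^ m))
      (isRatio-* _ _ (isRatio-/ C 1) (isRatio-^ ½ (isRatio-/ 1 2) m))

module Smoothing where

  open import Data.List using (List; []; _∷_; foldr)
  open import Data.List.Membership.Propositional using (_∈_)
  open import Data.List.Relation.Unary.Any using (here; there)
  open import Data.Product using (_,_)
  open import Data.Rational using (ℚ; 0ℚ; ½; ∣_∣; _-_; _+_; _*_; _≤_)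
  open import Data.Rational.Properties
  open import Algebra.Properties.Group +-0-group using (x∙y⁻¹≈ε⇒x≈y)
  open import Relation.Binary.PropositionalEquality
  open import Defs
  open Combinatorics using (bits-complete)

  foldr-+-≥-term : {A : Set} (F : A → ℚ) (xs : List A) → (∀ x → 0ℚ ≤ F x) → ∀ {x} → x ∈ xs → F x ≤ foldr (λ y s → F y + s) 0ℚ xs
  foldr-+-≥-term F (y ∷ xs) F≥0 (here refl) = subst (_≤ F y + _) (+-identityʳ (F y)) (+-monoʳ-≤ (F y) (foldr-+-≥-0 xs))
    where
    foldr-+-≥-0 : ∀ xs → 0ℚ ≤ foldr (λ y s → F y + s) 0ℚ xs
    foldr-+-≥-0 []       = ≤-refl
    foldr-+-≥-0 (y ∷ xs) = +-mono-≤ (F≥0 y) (foldr-+-≥-0 xs)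
  foldr-+-≥-term F (y ∷ xs) F≥0 (there x∈) = subst (_≤ F y + _) (+-identityˡ _) (+-mono-≤ (F≥0 y) (foldr-+-≥-term F xs F≥0 x∈))

  SD-≤-0 : ∀ t {p q : Bits t → ℚ} → SD t p q ≤ 0ℚ → ∀ z → p z ≡ q z
  SD-≤-0 t {p} {q} SD≤0 z = x∙y⁻¹≈ε⇒x≈y (p z) (q z) (∣p∣≡0⇒p≡0 _ (≤-antisym ∣pz-qz∣≤0 (0≤∣p∣ _)))
    where
    total≤0 : sumBits t (λ z → ∣ p z - q z ∣) ≤ 0ℚ
    total = sumBits t (λ z → ∣ p z - q z ∣)
    total≤0 = subst (_≤ 0ℚ) (trans (sym (*-distribʳ-+ total ½ ½)) (*-identityˡ total)) (+-mono-≤ SD≤0 SD≤0)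
    ∣pz-qz∣≤0 : ∣ p z - q z ∣ ≤ 0ℚ
    ∣pz-qz∣≤0 = ≤-trans (foldr-+-≥-term (λ z → ∣ p z - q z ∣) (allBits t) (λ _ → 0≤∣p∣ _) (bits-complete z)) total≤0

  smoothMinEntropyLe-0 : ∀ t (p : Bits t → ℚ) a z → TwoPowNegLe a (p z) → SmoothMinEntropyLe t 0ℚ p a
  smoothMinEntropyLe-0 t p a z heavy q _ SD≤0 = z , subst (TwoPowNegLe a) (SD-≤-0 t {p} {q} SD≤0 z) heavy

open Combinatorics using (heavyOutput-exists)
open MinEntropy using (twoPowNegLe-of-counts)
open Smoothing using (smoothMinEntropyLe-0)
open import Data.Integer using (+<+)
open import Data.Nat using (s≤s; z≤n)
open import Data.Product using (_,_)
open import Data.Rational using (1ℚ; *<*)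
open import Data.Rational.Properties using (≤-refl)

open import Defs
open import Data.Nat using (ℕ; _≤_; _*_)
open import Data.Integer using (+_)
open import Data.Rational using (ℚ; 0ℚ; _/_; _<_; _+_) renaming (_*_ to _*ℚ_; _≤_ to _≤ℚ_)
open import Data.Vec using (Vec)
open import Data.Product using (Σ; ∃; _×_)
open import Relation.Binary.PropositionalEquality using (_≡_)

mainTheorem7 : (g ℓ : ℕ) → .{{_ : Data.Nat.NonZero g}} → .{{_ : Data.Nat.NonZero ℓ}} →
    g ≤ ℓ → (∃ λ (c : ℕ) → g * c ≡ 2 * ℓ) →
    ∃ λ (ε : ℚ) → ∃ λ (δ : ℚ) → (0ℚ ≤ℚ ε) × (ε < (+ 1 / 4)) × (0ℚ < δ) ×
      ((n t : ℕ) → (f : Vec (Bits n) ℓ → Bits t) →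
        ∃ λ (X : NOSF g ℓ n) →
          SmoothMinEntropyLe t ε (distOf X f) (((+ g / ℓ) *ℚ (+ t / 1)) + δ))
mainTheorem7 g ℓ g≤ℓ g∣2ℓ = 0ℚ , 1ℚ , ≤-refl , *<* (+<+ (s≤s z≤n)) , *<* (+<+ (s≤s z≤n)) , exactSource
  where
  exactSource : (n t : ℕ) (f : Vec (Bits n) ℓ → Bits t) →
    ∃ λ (X : NOSF g ℓ n) → SmoothMinEntropyLe t 0ℚ (distOf X f) (((+ g / ℓ) *ℚ (+ t / 1)) + 1ℚ)
  exactSource n t f with heavyOutput-exists g≤ℓ g∣2ℓ f
  ... | X , z , heavy =
    X , smoothMinEntropyLe-0 t (distOf X f) (((+ g / ℓ) *ℚ (+ t / 1)) + 1ℚ) z (twoPowNegLe-of-counts (countPre X f z) (n * NOSF.k X) t g ℓ heavy)
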